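{- If $G$ is a linear $k$-tree (for a positive integer $k$), then $h(G)-1 = M(G) = Z(G) = k$, where $M(G)$ is taken over the real numbers.
   Context: For an integer $k\ge1$, a $k$-tree is a graph constructed by starting with a $(k+1)$-clique and repeating (zero or more times) the step: choose $k$ vertices inducing a clique and add a new vertex adjacent to exactly those $k$ vertices. A linear $k$-tree is a $k$-tree that either is a $(k+1)$-clique or has exactly two vertices of degree $k$. $h(G)$ is the Hadwiger number: the largest $t$ such that $G$ has $K_t$ as a minor. $M(G)$ is the maximum nullity of a real symmetric matrix whose off-diagonal $(i,j)$ entry is nonzero iff $\{i,j\}\in E(G)$ (diagonal arbitrary). $Z(G)$ is the zero forcing number: smallest size of an initially filled set from which repeatedly applying "a filled vertex whose only unfilled neighbor is $u$ forces $u$ to become filled" fills all vertices. -}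

module Defs where

open import Level using (0ℓ)
open import Data.Nat using (ℕ; zero; suc; _≤_)
open import Data.Bool using (Bool; true; false; not)
open import Data.Fin using (Fin; zero; suc; _≟_)
open import Data.Fin.Subset using (Subset; _∈_; ∣_∣)
open import Data.Vec using (lookup; tabulate)
open import Data.Maybe using (Maybe; just)
open import Data.Product using (Σ; ∃; ∃-syntax; _×_; _,_)
open import Data.Sum using (_⊎_)
open import Data.Empty using (⊥)
open import Relation.Nullary using (¬_; yes; no)
open import Relation.Nullary.Decidable using (⌊_⌋)
open import Relation.Binary.PropositionalEquality using (_≡_; _≢_; refl; sym)
open import Function.Bundles using (_↔_; Inverse)
open import Algebra.Bundles using (CommutativeRing)

record Graph (n : ℕ) : Set where
  field
    E      : Fin n → Fin n → Bool
    E-sym  : ∀ i j → E i j ≡ E j i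
    E-irr  : ∀ i → E i i ≡ false
open Graph public

Adj : ∀ {n} → Graph n → Fin n → Fin n → Set
Adj G i j = E G i j ≡ true

Iso : ∀ {n} → Graph n → Graph n → Set
Iso {n} G H = Σ (Fin n ↔ Fin n) λ σ →
  ∀ i j → E G i j ≡ E H (Inverse.to σ i) (Inverse.to σ j)

private
  neq-sym : ∀ {n} (i j : Fin n) → not ⌊ i ≟ j ⌋ ≡ not ⌊ j ≟ i ⌋
  neq-sym i j with i ≟ j | j ≟ i
  ... | yes _ | yes _ = refl
  ... | no _  | no _  = refl
  ... | yes p | no q  with q (sym p)
  ... | ()
  neq-sym i j | no p | yes q with p (sym q)
  ... | ()

  neq-irr : ∀ {n} (i : Fin n) → not ⌊ i ≟ i ⌋ ≡ false
  neq-irr i with i ≟ i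
  ... | yes _ = refl
  ... | no p with p refl
  ... | ()

complete : (n : ℕ) → Graph n
complete n = record { E = λ i j → not ⌊ i ≟ j ⌋ ; E-sym = neq-sym ; E-irr = neq-irr }

extend : ∀ {n} → Graph n → Subset n → Graph (suc n)
extend {n} G S = record { E = e ; E-sym = es ; E-irr = ei }
  where
  e : Fin (suc n) → Fin (suc n) → Bool
  e zero zero = false
  e zero (suc j) = lookup S j
  e (suc i) zero = lookup S i
  e (suc i) (suc j) = E G i j
  es : ∀ i j → e i j ≡ e j i
  es zero zero = refl
  es zero (suc j) = refl
  es (suc i) zero = refl
  es (suc i) (suc j) = E-sym G i j
  ei : ∀ i → e i i ≡ false
  ei zero = refl
  ei (suc i) = E-irr G i

IsCliqueSet : ∀ {n} → Graph n → Subset n → Set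
IsCliqueSet G S = ∀ i j → i ∈ S → j ∈ S → i ≢ j → Adj G i j

IsComplete : ∀ {n} → Graph n → Set
IsComplete G = ∀ i j → i ≢ j → Adj G i j

-- graphs obtained literally by the construction (new vertices labelled 0)
data KTreeBuild (k : ℕ) : ∀ {n} → Graph n → Set where
  base : KTreeBuild k (complete (suc k))
  step : ∀ {n} {G : Graph n} → KTreeBuild k G →
         (S : Subset n) → ∣ S ∣ ≡ k → IsCliqueSet G S →
         KTreeBuild k (extend G S)

IsKTree : ℕ → ∀ {n} → Graph n → Set
IsKTree k {n} G = Σ (Graph n) λ H → KTreeBuild k H × Iso G H

degree : ∀ {n} → Graph n → Fin n → ℕ
degree G i = ∣ tabulate (E G i) ∣

IsLinearKTree : ℕ → ∀ {n} → Graph n → Set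
IsLinearKTree k {n} G = IsKTree k G ×
  ((IsComplete G × n ≡ suc k) ⊎
   (Σ (Fin n) λ a → Σ (Fin n) λ b → a ≢ b × degree G a ≡ k × degree G b ≡ k ×
      (∀ c → degree G c ≡ k → c ≡ a ⊎ c ≡ b)))

data PathIn {n} (G : Graph n) (P : Fin n → Set) : Fin n → Fin n → Set where
  here  : ∀ {u} → P u → PathIn G P u u
  there : ∀ {u w v} → P u → Adj G u w → PathIn G P w v → PathIn G P u v

-- K_t minor via branch sets: f v = just a  means v lies in branch set a
HasCliqueMinor : ∀ {n} → Graph n → ℕ → Set
HasCliqueMinor {n} G t = Σ (Fin n → Maybe (Fin t)) λ f →
  (∀ a → ∃[ v ] f v ≡ just a) ×
  (∀ a u v → f u ≡ just a → f v ≡ just a → PathIn G (λ w → f w ≡ just a) u v) ×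
  (∀ a b → a ≢ b → ∃[ u ] ∃[ v ] (f u ≡ just a × f v ≡ just b × Adj G u v))

IsHadwigerNumber : ∀ {n} → Graph n → ℕ → Set
IsHadwigerNumber G t = HasCliqueMinor G t × (∀ s → HasCliqueMinor G s → s ≤ t)

data Filled {n} (G : Graph n) (S : Subset n) : Fin n → Set where
  init  : ∀ {v} → v ∈ S → Filled G S v
  force : ∀ {u v} → Filled G S u → Adj G u v →
          (∀ w → Adj G u w → w ≢ v → Filled G S w) → Filled G S v

IsZeroForcingSet : ∀ {n} → Graph n → Subset n → Set
IsZeroForcingSet G S = ∀ v → Filled G S v

IsZeroForcingNumber : ∀ {n} → Graph n → ℕ → Set
IsZeroForcingNumber {n} G m =
  (Σ (Subset n) λ S → ∣ S ∣ ≡ m × IsZeroForcingSet G S) ×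
  (∀ S → IsZeroForcingSet G S → m ≤ ∣ S ∣)

record Reals : Set₁ where
  field
    ℝring : CommutativeRing 0ℓ 0ℓ
  open CommutativeRing ℝring public hiding (ring)
  field
    _<_        : Carrier → Carrier → Set
    0≉1        : ¬ (0# ≈ 1#)
    inverse    : ∀ x → ¬ (x ≈ 0#) → ∃[ y ] (x * y ≈ 1#)
    <-resp-≈   : ∀ {x x′ y y′} → x ≈ x′ → y ≈ y′ → x < y → x′ < y′
    <-irrefl   : ∀ {x} → ¬ (x < x)
    <-trans    : ∀ {x y z} → x < y → y < z → x < z
    <-trichot  : ∀ x y → x < y ⊎ x ≈ y ⊎ y < x
    <-+        : ∀ {x y} z → x < y → (x + z) < (y + z)
    <-*        : ∀ {x y} → 0# < x → 0# < y → 0# < (x * y)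
    sup        : (P : Carrier → Set) → ∃[ x ] P x →
                 ∃[ b ] (∀ x → P x → x < b ⊎ x ≈ b) →
                 ∃[ s ] ((∀ x → P x → x < s ⊎ x ≈ s) ×
                         (∀ b → (∀ x → P x → x < b ⊎ x ≈ b) → s < b ⊎ s ≈ b))

module _ (R : Reals) where
  open Reals R using (Carrier; _≈_; _+_; _*_; 0#)

  sumF : ∀ {m} → (Fin m → Carrier) → Carrier
  sumF {zero} f = 0#
  sumF {suc m} f = f zero + sumF (λ i → f (suc i))

  Matrix : ℕ → Set
  Matrix n = Fin n → Fin n → Carrier

  InS : ∀ {n} → Graph n → Matrix n → Set
  InS G A = (∀ i j → A i j ≈ A j i) ×
            (∀ i j → i ≢ j → (¬ (A i j ≈ 0#) → Adj G i j) × (Adj G i j → ¬ (A i j ≈ 0#)))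

  InKernel : ∀ {n} → Matrix n → (Fin n → Carrier) → Set
  InKernel A x = ∀ i → sumF (λ j → A i j * x j) ≈ 0#

  LinIndep : ∀ {m n} → (Fin m → Fin n → Carrier) → Set
  LinIndep {m} {n} v = ∀ (c : Fin m → Carrier) → (∀ (i : Fin n) → sumF (λ a → c a * v a i) ≈ 0#) → ∀ a → c a ≈ 0#

  NullityAtLeast : ∀ {n} → Matrix n → ℕ → Set
  NullityAtLeast {n} A m = Σ (Fin m → Fin n → Carrier) λ v →
    (∀ a → InKernel A (v a)) × LinIndep v

  IsMaxNullity : ∀ {n} → Graph n → ℕ → Set
  IsMaxNullity {n} G m =
    (Σ (Matrix n) λ A → InS G A × NullityAtLeast A m) ×
    (∀ A → InS G A → ¬ NullityAtLeast A (suc m))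

-- Everything is proved for the graphs produced literally by KTreeBuild, by induction along
-- the construction, and then transported along the isomorphism.
--
-- The base clique K_{k+1} survives as a minor.  Conversely, take a K_t minor
-- of G extended by a vertex v attached to the k-clique T.  Either v can be removed from it
-- (paths and edges through v are rerouted inside the clique T), or v is a branch set on its
-- own; then every other branch set touches v, hence meets T, and t ≤ k + 1.
--
-- Every vertex has degree at least k, and the first force needs a
-- filled vertex with all but one of its neighbours filled, so Z ≥ k.  In a k-tree the
-- vertices of degree k are simplicial, and a linear k-tree has exactly two of them, a and b.
-- A k-clique A ∋ a is zero forcing: by induction, A fills the graph using only forcing
-- vertices outside any k-clique B that contains every simplicial vertex outside A, such as
-- a k-clique B ∋ b.
--
-- The cliques T ∪ {v} of the construction cover exactly the edges, so
-- Σ_C 1_C 1_Cᵀ has the pattern of G; its kernel contains k independent vectors summing to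
-- zero on every such clique (e_{a+1} − e_0 on K_{k+1}, extended to each new vertex so as to
-- balance its clique).  Conversely M ≤ Z: a kernel vector vanishing on a zero forcing set S
-- vanishes everywhere, and |S| + 1 vectors are dependent on the coordinates in S.

module Submission where

open import Defs
open import Algebra.Bundles using (CommutativeRing)
open import Data.Nat using (ℕ; zero; suc; _≤_; _<_; z≤n; s≤s; s≤s⁻¹)
import Data.Nat.Properties as ℕ
open import Data.Bool using (Bool; true; false; if_then_else_)
import Data.Bool.Properties as Bool
open import Data.Fin using (Fin; zero; suc; _≟_; punchIn)
open import Data.Fin.Properties
  using (suc-injective; 0≢1+n; any?; ¬∀⟶∃¬; injective⇒≤; punchInᵢ≢i; punchIn-injective)
open import Data.Fin.Subset
open import Data.Fin.Subset.Properties
open import Data.Maybe using (Maybe; just; nothing)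
open import Data.Maybe.Properties using (just-injective) renaming (≡-dec to ≡-dec-Maybe)
open import Data.Product using (Σ; ∃; ∃-syntax; _×_; _,_; proj₁; proj₂)
open import Data.Sum using (_⊎_; inj₁; inj₂; [_,_]′)
import Data.Sum as Sum
open import Data.Vec using ([]; _∷_; here; there; lookup; tabulate)
open import Data.Vec.Properties using (lookup⇒[]=; []=⇒lookup; lookup∘tabulate; tabulate∘lookup; tabulate-cong)
open import Data.Vec.Functional using (insertAt)
open import Data.Vec.Functional.Properties using (insertAt-lookup; insertAt-punchIn)
open import Function using (_∘_; Inverse)
open import Function.Definitions using (Injective)
open import Function.Properties.Inverse using (↔-sym)
open import Relation.Nullary using (¬_; Dec; yes; no; contradiction; ¬?)
open import Relation.Nullary.Decidable using (_×-dec_)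
open import Relation.Binary.PropositionalEquality
  using (_≡_; _≢_; refl; sym; trans; cong; cong₂; subst; subst₂; module ≡-Reasoning)
import Algebra.Properties.CommutativeMonoid.Sum ℕ.+-0-commutativeMonoid as ℕSum

private variable
  n t : ℕ
  x y : Fin n
  p q : Subset n

x∈p⇒∣p-x∣+1≡∣p∣ : x ∈ p → suc ∣ p - x ∣ ≡ ∣ p ∣
x∈p⇒∣p-x∣+1≡∣p∣ {p = inside ∷ p} here = cong suc (cong ∣_∣ (p─⊥≡p p))
x∈p⇒∣p-x∣+1≡∣p∣ {p = inside  ∷ p} (there x∈p) = cong suc (x∈p⇒∣p-x∣+1≡∣p∣ x∈p)
x∈p⇒∣p-x∣+1≡∣p∣ {p = outside ∷ p} (there x∈p) = x∈p⇒∣p-x∣+1≡∣p∣ x∈p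

∣p∪⁅x⁆∣≤∣p∣+1 : ∀ (p : Subset n) x → ∣ p ∪ ⁅ x ⁆ ∣ ≤ suc ∣ p ∣
∣p∪⁅x⁆∣≤∣p∣+1 (inside  ∷ p) zero    = ℕ.m≤n⇒m≤1+n (ℕ.≤-reflexive (cong (suc ∘ ∣_∣) (∪-identityʳ p)))
∣p∪⁅x⁆∣≤∣p∣+1 (outside ∷ p) zero    = s≤s (ℕ.≤-reflexive (cong ∣_∣ (∪-identityʳ p)))
∣p∪⁅x⁆∣≤∣p∣+1 (inside  ∷ p) (suc x) = s≤s (∣p∪⁅x⁆∣≤∣p∣+1 p x)
∣p∪⁅x⁆∣≤∣p∣+1 (outside ∷ p) (suc x) = ∣p∪⁅x⁆∣≤∣p∣+1 p x

x∉p⇒∣p∪⁅x⁆∣≡∣p∣+1 : x ∉ p → ∣ p ∪ ⁅ x ⁆ ∣ ≡ suc ∣ p ∣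
x∉p⇒∣p∪⁅x⁆∣≡∣p∣+1 {x = zero}  {p = inside  ∷ p} x∉p = contradiction here x∉p
x∉p⇒∣p∪⁅x⁆∣≡∣p∣+1 {x = zero}  {p = outside ∷ p} x∉p = cong (suc ∘ ∣_∣) (∪-identityʳ p)
x∉p⇒∣p∪⁅x⁆∣≡∣p∣+1 {x = suc x} {p = inside  ∷ p} x∉p = cong suc (x∉p⇒∣p∪⁅x⁆∣≡∣p∣+1 (drop-not-there x∉p))
x∉p⇒∣p∪⁅x⁆∣≡∣p∣+1 {x = suc x} {p = outside ∷ p} x∉p = x∉p⇒∣p∪⁅x⁆∣≡∣p∣+1 (drop-not-there x∉p)

∣p∣+1≡n : ∀ {n x} {p : Subset n} → x ∉ p → (∀ y → y ≢ x → y ∈ p) → suc ∣ p ∣ ≡ n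
∣p∣+1≡n {n} {x} {p} x∉p others = begin
  suc ∣ p ∣      ≡⟨ x∉p⇒∣p∪⁅x⁆∣≡∣p∣+1 x∉p ⟨
  ∣ p ∪ ⁅ x ⁆ ∣  ≡⟨ cong ∣_∣ (⊆-antisym ⊆⊤ ⊤⊆p∪⁅x⁆) ⟩
  ∣ ⊤ {n} ∣      ≡⟨ ∣⊤∣≡n n ⟩
  n              ∎
  where
  open ≡-Reasoning
  ⊤⊆p∪⁅x⁆ : ⊤ ⊆ p ∪ ⁅ x ⁆
  ⊤⊆p∪⁅x⁆ {y} _ with y ≟ x
  ... | yes refl = x∈p∪q⁺ (inj₂ (x∈⁅x⁆ x))
  ... | no y≢x   = x∈p∪q⁺ (inj₁ (others y y≢x))

exists-outside : ∣ p ∣ < ∣ q ∣ → ∃[ x ] x ∈ q × x ∉ p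
exists-outside {p = s ∷ p} {q = outside ∷ q} lt =
  there-outside (exists-outside (ℕ.<-≤-trans (s≤s (∣p∣≤∣x∷p∣ s p)) lt))
  where
  there-outside : ∃[ x ] x ∈ q × x ∉ p → ∃[ x ] x ∈ outside ∷ q × x ∉ s ∷ p
  there-outside (x , x∈q , x∉p) = suc x , there x∈q , x∉p ∘ drop-there
exists-outside {p = outside ∷ p} {q = inside ∷ q} _ = zero , here , λ ()
exists-outside {p = inside  ∷ p} {q = inside ∷ q} (s≤s lt) with exists-outside lt
... | x , x∈q , x∉p = suc x , there x∈q , x∉p ∘ drop-there

at-most-one-missing : p ⊆ q → ∣ q ∣ ≤ suc ∣ p ∣ → x ∈ q → x ∉ p → y ∈ q → y ≢ x → y ∈ p
at-most-one-missing {p = p} {q = q} {x = x} {y = y} p⊆q ∣q∣≤ x∈q x∉p y∈q y≢x with y ∈? p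
... | yes y∈p = y∈p
... | no  y∉p = contradiction (ℕ.<-≤-trans (p⊂q⇒∣p∣<∣q∣ p∪⁅x⁆⊂q) ∣q∣≤) (ℕ.<-irrefl (x∉p⇒∣p∪⁅x⁆∣≡∣p∣+1 x∉p))
  where
  p∪⁅x⁆⊂q : p ∪ ⁅ x ⁆ ⊂ q
  p∪⁅x⁆⊂q = (λ z∈ → [ p⊆q , (λ z∈⁅x⁆ → subst (_∈ q) (sym (x∈⁅y⁆⇒x≡y x z∈⁅x⁆)) x∈q) ]′ (x∈p∪q⁻ p ⁅ x ⁆ z∈))
          , y , y∈q , [ y∉p , y≢x ∘ x∈⁅y⁆⇒x≡y x ]′ ∘ x∈p∪q⁻ p ⁅ x ⁆

injective⇒≤∣p∣ : ∀ {m n} {p : Subset n} (f : Fin m → Fin n) → Injective _≡_ _≡_ f →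
                 (∀ a → f a ∈ p) → m ≤ ∣ p ∣
injective⇒≤∣p∣ {zero}  f f-inj f∈p = z≤n
injective⇒≤∣p∣ {suc m} {p = p} f f-inj f∈p =
  ℕ.≤-trans (s≤s (injective⇒≤∣p∣ (f ∘ suc) (suc-injective ∘ f-inj) f∘suc∈p-f0))
            (x∈p⇒∣p-x∣<∣p∣ (f∈p zero))
  where
  f∘suc∈p-f0 : ∀ a → f (suc a) ∈ p - f zero
  f∘suc∈p-f0 a = x∈p∧x≢y⇒x∈p-y (f∈p (suc a)) (λ e → 0≢1+n (sym (f-inj e)))

x∉p⇒lookup≡outside : x ∉ p → lookup p x ≡ outside
x∉p⇒lookup≡outside {x = x} {p = p} x∉p with lookup p x in eq
... | inside  = contradiction (lookup⇒[]= x p eq) x∉p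
... | outside = refl

enumerate : ∀ (p : Subset n) → Σ (Fin ∣ p ∣ → Fin n) λ e → ∀ {x} → x ∈ p → ∃[ i ] e i ≡ x
enumerate []            = (λ ()) , λ ()
enumerate (inside ∷ p)  with enumerate p
... | e , covers = e′ , covers′
  where
  e′ : Fin (suc ∣ p ∣) → Fin _
  e′ zero    = zero
  e′ (suc i) = suc (e i)
  covers′ : ∀ {x} → x ∈ inside ∷ p → ∃[ i ] e′ i ≡ x
  covers′ here        = zero , refl
  covers′ (there x∈p) with covers x∈p
  ... | i , eᵢ≡x = suc i , cong suc eᵢ≡x
enumerate (outside ∷ p) with enumerate p
... | e , covers = suc ∘ e , covers′
  where
  covers′ : ∀ {x} → x ∈ outside ∷ p → ∃[ i ] suc (e i) ≡ x
  covers′ (there x∈p) with covers x∈p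
  ... | i , eᵢ≡x = i , cong suc eᵢ≡x

N : Graph n → Fin n → Subset n
N G i = tabulate (E G i)

Adj⇒∈N : ∀ (G : Graph n) i {j} → Adj G i j → j ∈ N G i
Adj⇒∈N G i {j} adj = lookup⇒[]= j (N G i) (trans (lookup∘tabulate (E G i) j) adj)

∈N⇒Adj : ∀ (G : Graph n) i {j} → j ∈ N G i → Adj G i j
∈N⇒Adj G i {j} j∈N = trans (sym (lookup∘tabulate (E G i) j)) ([]=⇒lookup j∈N)

Adj-sym : ∀ {G : Graph n} {i j} → Adj G i j → Adj G j i
Adj-sym {G = G} {i = i} {j = j} = trans (E-sym G j i)

Adj-irrefl : ∀ {G : Graph n} {i} → ¬ Adj G i i
Adj-irrefl {G = G} {i = i} adj with () ← trans (sym adj) (E-irr G i)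

Adj⇒≢ : ∀ {G : Graph n} {i j} → Adj G i j → i ≢ j
Adj⇒≢ {G = G} adj refl = Adj-irrefl {G = G} adj

i∉N[i] : ∀ (G : Graph n) i → i ∉ N G i
i∉N[i] G i = Adj-irrefl {G = G} ∘ ∈N⇒Adj G i

Adj-complete : ∀ {i j : Fin n} → i ≢ j → Adj (complete n) i j
Adj-complete {i = i} {j = j} i≢j with i ≟ j
... | yes i≡j = contradiction i≡j i≢j
... | no  _   = refl

degree-complete : ∀ (i : Fin n) → suc (degree (complete n) i) ≡ n
degree-complete i = ∣p∣+1≡n (i∉N[i] (complete _) i) (λ j j≢i → Adj⇒∈N (complete _) i (Adj-complete (j≢i ∘ sym)))

module _ {G : Graph n} {T : Subset n} where

  ∈⇒Adj-new : ∀ {j} → j ∈ T → Adj (extend G T) zero (suc j)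
  ∈⇒Adj-new = []=⇒lookup

  Adj-new⇒∈ : ∀ {j} → Adj (extend G T) zero (suc j) → j ∈ T
  Adj-new⇒∈ {j} = lookup⇒[]= j T

module _ (G : Graph n) (T : Subset n) where

  degree-new : degree (extend G T) zero ≡ ∣ T ∣
  degree-new = cong ∣_∣ (tabulate∘lookup T)

  degree-old : ∀ i → degree G i ≤ degree (extend G T) (suc i)
  degree-old i = ∣p∣≤∣x∷p∣ (lookup T i) (N G i)

  degree-old-∉ : ∀ {i} → i ∉ T → degree (extend G T) (suc i) ≡ degree G i
  degree-old-∉ i∉T rewrite x∉p⇒lookup≡outside i∉T = refl

  degree-old-∈ : ∀ {i} → i ∈ T → degree (extend G T) (suc i) ≡ suc (degree G i)
  degree-old-∈ i∈T rewrite []=⇒lookup i∈T = refl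

module _ {G : Graph n} {T : Subset n} where

  clique-old : ∀ {s A} → IsCliqueSet (extend G T) (s ∷ A) → IsCliqueSet G A
  clique-old clique i j i∈A j∈A i≢j = clique (suc i) (suc j) (there i∈A) (there j∈A) (i≢j ∘ suc-injective)

  clique-new : ∀ {A} → IsCliqueSet (extend G T) (inside ∷ A) → A ⊆ T
  clique-new clique j∈A = Adj-new⇒∈ {G = G} (clique zero (suc _) here (there j∈A) λ ())

clique-⊆ : ∀ {G : Graph n} {A B} → A ⊆ B → IsCliqueSet G B → IsCliqueSet G A
clique-⊆ A⊆B clique i j i∈A j∈A = clique i j (A⊆B i∈A) (A⊆B j∈A)

clique-closed-neighbourhood : ∀ {G : Graph n} {s} → IsCliqueSet G (N G s) → IsCliqueSet G (N G s ∪ ⁅ s ⁆)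
clique-closed-neighbourhood {G = G} {s} clique i j i∈ j∈ i≢j
  with x∈p∪q⁻ (N G s) ⁅ s ⁆ i∈ | x∈p∪q⁻ (N G s) ⁅ s ⁆ j∈
... | inj₁ i∈N | inj₁ j∈N = clique i j i∈N j∈N i≢j
... | inj₁ i∈N | inj₂ j∈s rewrite x∈⁅y⁆⇒x≡y s j∈s = Adj-sym {G = G} (∈N⇒Adj G s i∈N)
... | inj₂ i∈s | inj₁ j∈N rewrite x∈⁅y⁆⇒x≡y s i∈s = ∈N⇒Adj G s j∈N
... | inj₂ i∈s | inj₂ j∈s = contradiction (trans (x∈⁅y⁆⇒x≡y s i∈s) (sym (x∈⁅y⁆⇒x≡y s j∈s))) i≢j

-- k-trees

module _ {k : ℕ} where

  ktree-size : ∀ {n} {G : Graph n} → KTreeBuild k G → suc k ≤ n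
  ktree-size base              = ℕ.≤-refl
  ktree-size (step built _ _ _) = ℕ.m≤n⇒m≤1+n (ktree-size built)

  ktree-min-degree : ∀ {n} {G : Graph n} → KTreeBuild k G → ∀ i → k ≤ degree G i
  ktree-min-degree base i = ℕ.≤-reflexive (sym (ℕ.suc-injective (degree-complete i)))
  ktree-min-degree (step {G = G} built T ∣T∣≡k _) zero    = ℕ.≤-reflexive (sym (trans (degree-new G T) ∣T∣≡k))
  ktree-min-degree (step {G = G} built T _ _)     (suc i) = ℕ.≤-trans (ktree-min-degree built i) (degree-old G T i)

  ktree-clique-misses-simplicial : ∀ {n} {G : Graph n} → KTreeBuild k G →
    ∀ {A} → IsCliqueSet G A → ∣ A ∣ ≡ k → ∃[ i ] degree G i ≡ k × i ∉ A
  ktree-clique-misses-simplicial base {A} _ ∣A∣≡k with exists-outside {p = A} {q = ⊤} ∣A∣<∣⊤∣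
    where
    ∣A∣<∣⊤∣ : ∣ A ∣ < ∣ ⊤ {suc k} ∣
    ∣A∣<∣⊤∣ = subst₂ _<_ (sym ∣A∣≡k) (sym (∣⊤∣≡n (suc k))) (ℕ.n<1+n k)
  ... | i , _ , i∉A = i , ℕ.suc-injective (degree-complete i) , i∉A
  ktree-clique-misses-simplicial (step {G = G} built T ∣T∣≡k _) {outside ∷ A} _ _ =
    zero , trans (degree-new G T) ∣T∣≡k , λ ()
  ktree-clique-misses-simplicial (step {G = G} built T ∣T∣≡k T-clique) {inside ∷ A} A-clique _
    with ktree-clique-misses-simplicial built T-clique ∣T∣≡k
  ... | i , deg , i∉T = suc i , trans (degree-old-∉ G T i∉T) deg , i∉T ∘ clique-new A-clique ∘ drop-there

  ktree-simplicial-clique : ∀ {n} {G : Graph n} → KTreeBuild k G →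
    ∀ {s} → degree G s ≡ k → IsCliqueSet G (N G s)
  ktree-simplicial-clique base _ i j _ _ i≢j = Adj-complete i≢j
  ktree-simplicial-clique (step {G = G} built T _ T-clique) {zero} _ = new-clique
    where
    new-clique : IsCliqueSet (extend G T) (N (extend G T) zero)
    new-clique zero    _       0∈N _   _   = contradiction 0∈N (i∉N[i] (extend G T) zero)
    new-clique (suc i) zero    _   0∈N _   = contradiction 0∈N (i∉N[i] (extend G T) zero)
    new-clique (suc i) (suc j) i∈N j∈N i≢j =
      T-clique i j (Adj-new⇒∈ {G = G} (∈N⇒Adj (extend G T) zero i∈N))
                   (Adj-new⇒∈ {G = G} (∈N⇒Adj (extend G T) zero j∈N)) (i≢j ∘ cong suc)
  ktree-simplicial-clique (step {G = G} built T _ _) {suc s} deg with s ∈? T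
  ... | yes s∈T = contradiction (trans (sym (degree-old-∈ G T s∈T)) deg)
                                (ℕ.<⇒≢ (s≤s (ktree-min-degree built s)) ∘ sym)
  ... | no  s∉T = old-clique
    where
    0∈N⇒s∈T : zero ∈ N (extend G T) (suc s) → s ∈ T
    0∈N⇒s∈T 0∈N =
      Adj-new⇒∈ {G = G} (Adj-sym {G = extend G T} {i = suc s} {j = zero} (∈N⇒Adj (extend G T) (suc s) 0∈N))
    old-clique : IsCliqueSet (extend G T) (N (extend G T) (suc s))
    old-clique zero    _       0∈N _   _   = contradiction (0∈N⇒s∈T 0∈N) s∉T
    old-clique (suc i) zero    _   0∈N _   = contradiction (0∈N⇒s∈T 0∈N) s∉T
    old-clique (suc i) (suc j) i∈N j∈N i≢j =
      ktree-simplicial-clique built (trans (sym (degree-old-∉ G T s∉T)) deg)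
        i j (drop-there i∈N) (drop-there j∈N) (i≢j ∘ cong suc)

  ktree-clique-through : ∀ {n} {G : Graph n} → 1 ≤ k → KTreeBuild k G →
    ∀ {s} → degree G s ≡ k → ∃[ A ] IsCliqueSet G A × ∣ A ∣ ≡ k × s ∈ A
  ktree-clique-through {n} {G} 1≤k built {s} deg
    with exists-outside {p = ⊥} {q = N G s} (subst₂ _<_ (sym (∣⊥∣≡0 n)) (sym deg) 1≤k)
  ... | t , t∈N , _ =
    N[s] - t , clique-⊆ {G = G} (p─q⊆p N[s] ⁅ t ⁆) N[s]-clique , ∣N[s]-t∣≡k , s∈N[s]-t
    where
    N[s] : Subset n
    N[s] = N G s ∪ ⁅ s ⁆
    N[s]-clique : IsCliqueSet G N[s]
    N[s]-clique = clique-closed-neighbourhood {G = G} (ktree-simplicial-clique built deg)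
    s∈N[s]-t : s ∈ N[s] - t
    s∈N[s]-t = x∈p∧x≢y⇒x∈p-y (x∈p∪q⁺ (inj₂ (x∈⁅x⁆ s))) (λ { refl → i∉N[i] G s t∈N })
    ∣N[s]-t∣≡k : ∣ N[s] - t ∣ ≡ k
    ∣N[s]-t∣≡k = ℕ.suc-injective (begin
      suc ∣ N[s] - t ∣  ≡⟨ x∈p⇒∣p-x∣+1≡∣p∣ (x∈p∪q⁺ (inj₁ t∈N)) ⟩
      ∣ N[s] ∣          ≡⟨ x∉p⇒∣p∪⁅x⁆∣≡∣p∣+1 (i∉N[i] G s) ⟩
      suc ∣ N G s ∣     ≡⟨ cong suc deg ⟩
      suc k             ∎)
      where open ≡-Reasoning

-- Zero forcing

data FilledAvoiding (G : Graph n) (S X : Subset n) : Fin n → Set where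
  init  : ∀ {v} → v ∈ S → FilledAvoiding G S X v
  force : ∀ {u v} → FilledAvoiding G S X u → u ∉ X → Adj G u v →
          (∀ w → Adj G u w → w ≢ v → FilledAvoiding G S X w) → FilledAvoiding G S X v

FilledAvoiding⇒Filled : ∀ {G : Graph n} {S X v} → FilledAvoiding G S X v → Filled G S v
FilledAvoiding⇒Filled (init v∈S) = init v∈S
FilledAvoiding⇒Filled (force filled _ adj rest) =
  force (FilledAvoiding⇒Filled filled) adj (λ w adj′ w≢v → FilledAvoiding⇒Filled (rest w adj′ w≢v))

module _ {G : Graph n} {T : Subset n} {S X : Subset (suc n)} where

  lift-filled : ∀ {S₀ X₀} →
    (∀ {x} → x ∈ S₀ → FilledAvoiding (extend G T) S X (suc x)) →
    (∀ {u} → u ∉ X₀ → suc u ∉ X) →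
    (∀ {u} → u ∉ X₀ → u ∈ T → FilledAvoiding (extend G T) S X zero) →
    ∀ {v} → FilledAvoiding G S₀ X₀ v → FilledAvoiding (extend G T) S X (suc v)
  lift-filled initial avoid new (init x∈S₀) = initial x∈S₀
  lift-filled initial avoid new (force {u} {v} filled u∉X₀ adj rest) =
    force (lift-filled initial avoid new filled) (avoid u∉X₀) adj rest′
    where
    rest′ : ∀ w → Adj (extend G T) (suc u) w → w ≢ suc v → FilledAvoiding (extend G T) S X w
    rest′ zero    adj₀ _     = new u∉X₀ (Adj-new⇒∈ {G = G} adj₀)
    rest′ (suc w) adjw w≢v = lift-filled initial avoid new (rest w adjw (w≢v ∘ cong suc))

  fill-new : (∀ v → FilledAvoiding (extend G T) S X (suc v)) →
             ∀ {t} → t ∈ T → suc t ∉ X → FilledAvoiding (extend G T) S X zero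
  fill-new old t∈T t∉X = force (old _) t∉X (∈⇒Adj-new {G = G} t∈T) others
    where
    others : ∀ w → Adj (extend G T) (suc _) w → w ≢ zero → FilledAvoiding (extend G T) S X w
    others zero    _ 0≢0 = contradiction refl 0≢0
    others (suc w) _ _   = old w

module _ (k : ℕ) where

  -- Attaching a vertex to B leaves intact every force made by a vertex outside B; this is
  -- what lets the induction pass through the construction.
  CliqueForcing : Graph n → Set
  CliqueForcing {n} G = ∀ {A B : Subset n} →
    IsCliqueSet G A → ∣ A ∣ ≡ k → IsCliqueSet G B → ∣ B ∣ ≡ k →
    (∀ i → degree G i ≡ k → i ∉ A → i ∈ B) → ∀ v → FilledAvoiding G A B v

  clique-forcing-complete : CliqueForcing (complete (suc k))
  clique-forcing-complete {A} {B} _ ∣A∣≡k _ ∣B∣≡k simplicial⊆B v with v ∈? A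
  ... | yes v∈A = init v∈A
  ... | no  v∉A = force (init w∈A) w∉B (Adj-complete w≢v) (λ y _ y≢v → init (in-A y≢v))
    where
    in-A : ∀ {y} → y ≢ v → y ∈ A
    in-A y≢v = at-most-one-missing ⊆⊤ (ℕ.≤-reflexive (trans (∣⊤∣≡n (suc k)) (cong suc (sym ∣A∣≡k)))) ∈⊤ v∉A ∈⊤ y≢v
    v∈B : v ∈ B
    v∈B = simplicial⊆B v (ℕ.suc-injective (degree-complete v)) v∉A
    outside-B : ∃[ w ] w ∈ ⊤ × w ∉ B
    outside-B = exists-outside (subst₂ _<_ (sym ∣B∣≡k) (sym (∣⊤∣≡n (suc k))) (ℕ.n<1+n k))
    w : Fin (suc k)
    w = proj₁ outside-B
    w∉B : w ∉ B
    w∉B = proj₂ (proj₂ outside-B)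
    w≢v : w ≢ v
    w≢v refl = w∉B v∈B
    w∈A : w ∈ A
    w∈A = in-A w≢v

  module _ {n} {G : Graph n} {T : Subset n} (built : KTreeBuild k G)
           (T-clique : IsCliqueSet G T) (∣T∣≡k : ∣ T ∣ ≡ k) (forcing : CliqueForcing G) where

    private
      G⁺ : Graph (suc n)
      G⁺ = extend G T

      degree-old-simplicial : ∀ {i} → degree G i ≡ k → i ∉ T → degree G⁺ (suc i) ≡ k
      degree-old-simplicial deg i∉T = trans (degree-old-∉ G T i∉T) deg

    new-vertex-forces-T : ∀ {A B} →
      IsCliqueSet G⁺ (inside ∷ A) → ∣ inside ∷ A ∣ ≡ k → IsCliqueSet G⁺ (outside ∷ B) → ∣ B ∣ ≡ k →
      (∀ i → degree G⁺ i ≡ k → i ∉ inside ∷ A → i ∈ outside ∷ B) →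
      ∀ v → FilledAvoiding G⁺ (inside ∷ A) (outside ∷ B) v
    new-vertex-forces-T {A} {B} A-clique ∣A∣+1≡k B-clique ∣B∣≡k simplicial⊆B = filled
      where
      A⊆T : A ⊆ T
      A⊆T = clique-new A-clique
      from-T : ∀ v → FilledAvoiding G T B v
      from-T = forcing T-clique ∣T∣≡k (clique-old B-clique) ∣B∣≡k
        (λ i deg i∉T → drop-there (simplicial⊆B (suc i) (degree-old-simplicial deg i∉T) (i∉T ∘ A⊆T ∘ drop-there)))
      T-filled : ∀ {x} → x ∈ T → FilledAvoiding G⁺ (inside ∷ A) (outside ∷ B) (suc x)
      T-filled {x} x∈T with x ∈? A
      ... | yes x∈A = init (there x∈A)
      ... | no  x∉A = force (init here) (λ ()) (∈⇒Adj-new {G = G} x∈T) others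
        where
        others : ∀ w → Adj G⁺ zero w → w ≢ suc x → FilledAvoiding G⁺ (inside ∷ A) (outside ∷ B) w
        others (suc w) adj w≢x = init (there (at-most-one-missing A⊆T (ℕ.≤-reflexive (trans ∣T∣≡k (sym ∣A∣+1≡k)))
                                                             x∈T x∉A (Adj-new⇒∈ {G = G} adj) (w≢x ∘ cong suc)))
      filled : ∀ v → FilledAvoiding G⁺ (inside ∷ A) (outside ∷ B) v
      filled zero    = init here
      filled (suc v) = lift-filled T-filled (_∘ drop-there) (λ _ _ → init here) (from-T v)

    T-forces-new-vertex : ∀ {A B} →
      IsCliqueSet G⁺ (outside ∷ A) → ∣ A ∣ ≡ k → IsCliqueSet G⁺ (inside ∷ B) → ∣ inside ∷ B ∣ ≡ k →
      (∀ i → degree G⁺ i ≡ k → i ∉ outside ∷ A → i ∈ inside ∷ B) →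
      ∀ v → FilledAvoiding G⁺ (outside ∷ A) (inside ∷ B) v
    T-forces-new-vertex {A} {B} A-clique ∣A∣≡k B-clique ∣B∣+1≡k simplicial⊆B = filled
      where
      B⊆T : B ⊆ T
      B⊆T = clique-new B-clique
      simplicial⊆T : ∀ i → degree G i ≡ k → i ∉ A → i ∈ T
      simplicial⊆T i deg i∉A with i ∈? T
      ... | yes i∈T = i∈T
      ... | no  i∉T = B⊆T (drop-there (simplicial⊆B (suc i) (degree-old-simplicial deg i∉T) (i∉A ∘ drop-there)))
      old-filled : ∀ v → FilledAvoiding G⁺ (outside ∷ A) (inside ∷ B) (suc v)
      old-filled v = lift-filled (λ x∈A → init (there x∈A)) (λ u∉T u∈B → u∉T (B⊆T (drop-there u∈B)))
                                 (λ u∉T u∈T → contradiction u∈T u∉T)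
                                 (forcing (clique-old A-clique) ∣A∣≡k T-clique ∣T∣≡k simplicial⊆T v)
      outside-B : ∃[ t ] t ∈ T × t ∉ B
      outside-B = exists-outside (subst (∣ B ∣ <_) (trans ∣B∣+1≡k (sym ∣T∣≡k)) (ℕ.n<1+n ∣ B ∣))
      filled : ∀ v → FilledAvoiding G⁺ (outside ∷ A) (inside ∷ B) v
      filled zero    = fill-new old-filled (proj₁ (proj₂ outside-B)) (proj₂ (proj₂ outside-B) ∘ drop-there)
      filled (suc v) = old-filled v

    clique-forcing-extend : CliqueForcing G⁺
    clique-forcing-extend {outside ∷ A} {outside ∷ B} _ _ _ _ simplicial⊆B =
      contradiction (simplicial⊆B zero (trans (degree-new G T) ∣T∣≡k) λ ()) λ ()
    clique-forcing-extend {inside ∷ A} {inside ∷ B} A-clique _ B-clique _ simplicial⊆B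
      with ktree-clique-misses-simplicial built T-clique ∣T∣≡k
    ... | i , deg , i∉T =
      contradiction (clique-new B-clique (drop-there (simplicial⊆B (suc i) (degree-old-simplicial deg i∉T)
                                                                  (i∉T ∘ clique-new A-clique ∘ drop-there))))
                    i∉T
    clique-forcing-extend {inside ∷ A} {outside ∷ B} = new-vertex-forces-T
    clique-forcing-extend {outside ∷ A} {inside ∷ B} = T-forces-new-vertex

  ktree-clique-forcing : ∀ {n} {G : Graph n} → KTreeBuild k G → CliqueForcing G
  ktree-clique-forcing base                        = clique-forcing-complete
  ktree-clique-forcing (step built T ∣T∣≡k T-clique) =
    clique-forcing-extend built T-clique ∣T∣≡k (ktree-clique-forcing built)

  ktree-zero-forcing-set : ∀ {n} {G : Graph n} → 1 ≤ k → KTreeBuild k G → ∀ {a b} →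
    degree G a ≡ k → degree G b ≡ k → (∀ c → degree G c ≡ k → c ≡ a ⊎ c ≡ b) →
    Σ (Subset n) λ S → ∣ S ∣ ≡ k × IsZeroForcingSet G S
  ktree-zero-forcing-set {G = G} 1≤k built {a} {b} deg-a deg-b simplicial
    with ktree-clique-through 1≤k built deg-a | ktree-clique-through 1≤k built deg-b
  ... | A , A-clique , ∣A∣≡k , a∈A | B , B-clique , ∣B∣≡k , b∈B =
    A , ∣A∣≡k , λ v → FilledAvoiding⇒Filled (ktree-clique-forcing built A-clique ∣A∣≡k B-clique ∣B∣≡k simplicial⊆B v)
    where
    simplicial⊆B : ∀ c → degree G c ≡ k → c ∉ A → c ∈ B
    simplicial⊆B c deg c∉A with simplicial c deg
    ... | inj₁ refl = contradiction a∈A c∉A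
    ... | inj₂ refl = b∈B

complete-zero-forcing-set : ∀ {n} {G : Graph (suc (suc n))} → IsComplete G → IsZeroForcingSet G (outside ∷ ⊤)
complete-zero-forcing-set {G = G} complete zero    = force (init (there ∈⊤)) (complete (suc zero) zero λ ()) others
  where
  others : ∀ w → Adj G (suc zero) w → w ≢ zero → Filled G (outside ∷ ⊤) w
  others zero    _ 0≢0 = contradiction refl 0≢0
  others (suc w) _ _   = init (there ∈⊤)
complete-zero-forcing-set complete (suc v) = init (there ∈⊤)

first-force : ∀ {G : Graph n} {S v} → Filled G S v →
  v ∈ S ⊎ ∃[ u ] u ∈ S × ∃[ v′ ] (∀ w → Adj G u w → w ≢ v′ → w ∈ S)
first-force (init v∈S) = inj₁ v∈S
first-force {G = G} {S} (force {u} {v} filled adj rest) with first-force filled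
... | inj₂ found = inj₂ found
... | inj₁ u∈S with any? (λ w → (E G u w Bool.≟ true) ×-dec ¬? (w ≟ v) ×-dec ¬? (w ∈? S))
...   | yes (w , adjw , w≢v , w∉S) = [ (λ w∈S → contradiction w∈S w∉S) , inj₂ ]′ (first-force (rest w adjw w≢v))
...   | no  none = inj₂ (u , u∈S , v , filled-neighbour)
  where
  filled-neighbour : ∀ w → Adj G u w → w ≢ v → w ∈ S
  filled-neighbour w adjw w≢v with w ∈? S
  ... | yes w∈S = w∈S
  ... | no  w∉S = contradiction (w , adjw , w≢v , w∉S) none

zero-forcing-≥-min-degree : ∀ {G : Graph n} {k} → k ≤ n → (∀ i → k ≤ degree G i) →
  ∀ S → IsZeroForcingSet G S → k ≤ ∣ S ∣
zero-forcing-≥-min-degree {n} {G} {k} k≤n k≤degree S zero-forcing with ⊤ ⊆? S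
... | yes ⊤⊆S = ℕ.≤-trans k≤n (subst (_≤ ∣ S ∣) (∣⊤∣≡n n) (p⊆q⇒∣p∣≤∣q∣ ⊤⊆S))
... | no  ⊤⊈S with ¬∀⟶∃¬ n (_∈ S) (_∈? S) (λ all → ⊤⊈S (λ {x} _ → all x))
...   | v , v∉S with first-force (zero-forcing v)
...     | inj₁ v∈S = contradiction v∈S v∉S
...     | inj₂ (u , u∈S , v′ , filled-neighbour) = ℕ.≤-trans (k≤degree u) (s≤s⁻¹ (begin
  suc (degree G u)     ≡⟨ x∉p⇒∣p∪⁅x⁆∣≡∣p∣+1 (i∉N[i] G u) ⟨
  ∣ N G u ∪ ⁅ u ⁆ ∣     ≤⟨ p⊆q⇒∣p∣≤∣q∣ N[u]⊆S∪⁅v′⁆ ⟩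
  ∣ S ∪ ⁅ v′ ⁆ ∣        ≤⟨ ∣p∪⁅x⁆∣≤∣p∣+1 S v′ ⟩
  suc ∣ S ∣             ∎))
  where
  open ℕ.≤-Reasoning
  N[u]⊆S∪⁅v′⁆ : N G u ∪ ⁅ u ⁆ ⊆ S ∪ ⁅ v′ ⁆
  N[u]⊆S∪⁅v′⁆ {w} w∈ with x∈p∪q⁻ (N G u) ⁅ u ⁆ w∈ | w ≟ v′
  ... | inj₂ w∈⁅u⁆ | _        = x∈p∪q⁺ (inj₁ (subst (_∈ S) (sym (x∈⁅y⁆⇒x≡y u w∈⁅u⁆)) u∈S))
  ... | inj₁ _     | yes refl = x∈p∪q⁺ (inj₂ (x∈⁅x⁆ v′))
  ... | inj₁ w∈N   | no  w≢v′ = x∈p∪q⁺ (inj₁ (filled-neighbour w (∈N⇒Adj G u w∈N) w≢v′))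

-- Clique minors

minor-size : ∀ {G : Graph n} → HasCliqueMinor G t → t ≤ n
minor-size (f , nonempty , _ , _) = injective⇒≤ representative-injective
  where
  representative-injective : ∀ {a b} → proj₁ (nonempty a) ≡ proj₁ (nonempty b) → a ≡ b
  representative-injective {a} {b} e =
    just-injective (trans (sym (proj₂ (nonempty a))) (trans (cong f e) (proj₂ (nonempty b))))

complete-minor : HasCliqueMinor (complete n) n
complete-minor = just , (λ a → a , refl) , connected , λ a b a≢b → a , b , refl , refl , Adj-complete a≢b
  where
  connected : ∀ a u v → just u ≡ just a → just v ≡ just a → PathIn (complete _) (λ w → just w ≡ just a) u v
  connected a u v refl refl = here refl

distinct-branches : ∀ {A B : Set} {f : A → Maybe B} {u v a b} → f u ≡ just a → f v ≡ just b → a ≢ b → u ≢ v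
distinct-branches fu fv a≢b refl = a≢b (just-injective (trans (sym fu) fv))

path-head : ∀ {G : Graph n} {P : Fin n → Set} {u v} → PathIn G P u v → P u
path-head (here p)      = p
path-head (there p _ _) = p

module _ {G : Graph n} {T : Subset n} where

  path-lift : ∀ {P : Fin (suc n) → Set} {u v} → PathIn G (P ∘ suc) u v → PathIn (extend G T) P (suc u) (suc v)
  path-lift (here p)           = here p
  path-lift (there p adj rest) = there p adj (path-lift rest)

  minor-extend : HasCliqueMinor G t → HasCliqueMinor (extend G T) t
  minor-extend {t} (f , nonempty , connected , touching) =
    f′ , (λ a → suc (proj₁ (nonempty a)) , proj₂ (nonempty a)) , connected′ , touching′
    where
    f′ : Fin (suc n) → Maybe (Fin t)
    f′ zero    = nothing
    f′ (suc v) = f v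
    connected′ : ∀ a u v → f′ u ≡ just a → f′ v ≡ just a → PathIn (extend G T) (λ w → f′ w ≡ just a) u v
    connected′ a (suc u) (suc v) fu fv = path-lift (connected a u v fu fv)
    touching′ : ∀ a b → a ≢ b → ∃[ u ] ∃[ v ] (f′ u ≡ just a × f′ v ≡ just b × Adj (extend G T) u v)
    touching′ a b a≢b with touching a b a≢b
    ... | u , v , fu , fv , adj = suc u , suc v , fu , fv , adj

  path-drop-new : IsCliqueSet G T → ∀ {P : Fin (suc n) → Set} {u v} →
    PathIn (extend G T) P (suc u) (suc v) → PathIn G (P ∘ suc) u v
  path-drop-new T-clique (here p) = here p
  path-drop-new T-clique (there {w = suc w} p adj rest) = there p adj (path-drop-new T-clique rest)
  path-drop-new T-clique (there {u = suc u} {w = zero} p adj (there {w = suc y} _ adj′ rest)) with u ≟ y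
  ... | yes refl = path-drop-new T-clique rest
  ... | no  u≢y  = there p (T-clique u y (Adj-new⇒∈ {G = G} adj) (Adj-new⇒∈ {G = G} adj′) u≢y)
                         (path-drop-new T-clique rest)

  minor-delete-new : IsCliqueSet G T → (f : Fin (suc n) → Maybe (Fin t)) →
    (∀ a u v → f u ≡ just a → f v ≡ just a → PathIn (extend G T) (λ w → f w ≡ just a) u v) →
    (∀ a → ∃[ v ] f (suc v) ≡ just a) →
    (∀ a b → a ≢ b → ∃[ u ] ∃[ v ] (f (suc u) ≡ just a × f (suc v) ≡ just b × Adj G u v)) →
    HasCliqueMinor G t
  minor-delete-new T-clique f connected nonempty touching =
    f ∘ suc , nonempty , (λ a u v fu fv → path-drop-new T-clique (connected a (suc u) (suc v) fu fv)) , touching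

  first-step : ∀ {P : Fin (suc n) → Set} {v} → PathIn (extend G T) P zero (suc v) → ∃[ x ] x ∈ T × P (suc x)
  first-step (there {w = suc x} _ adj rest) = x , Adj-new⇒∈ {G = G} adj , path-head rest

  minor-contract-new : IsCliqueSet G T → (f : Fin (suc n) → Maybe (Fin t)) →
    (∀ a u v → f u ≡ just a → f v ≡ just a → PathIn (extend G T) (λ w → f w ≡ just a) u v) →
    (∀ a → ∃[ v ] f v ≡ just a) →
    (∀ a b → a ≢ b → ∃[ u ] ∃[ v ] (f u ≡ just a × f v ≡ just b × Adj (extend G T) u v)) →
    ∀ {a x₀} → f zero ≡ just a → f (suc x₀) ≡ just a → HasCliqueMinor G t
  minor-contract-new T-clique f connected nonempty touching {a} f0 fx₀
    with first-step (connected a zero (suc _) f0 fx₀)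
  ... | x , x∈T , fx≡a = minor-delete-new T-clique f connected nonempty′ touching′
    where
    fx≡ : ∀ {b} → f zero ≡ just b → f (suc x) ≡ just b
    fx≡ f0≡b = trans fx≡a (trans (sym f0) f0≡b)
    nonempty′ : ∀ b → ∃[ v ] f (suc v) ≡ just b
    nonempty′ b with nonempty b
    ... | zero  , f0≡b = x , fx≡ f0≡b
    ... | suc v , fv   = v , fv
    touching′ : ∀ b c → b ≢ c → ∃[ u ] ∃[ v ] (f (suc u) ≡ just b × f (suc v) ≡ just c × Adj G u v)
    touching′ b c b≢c with touching b c b≢c
    ... | zero  , suc y , f0≡b , fy , adj =
      x , y , fx≡ f0≡b , fy ,
      T-clique x y x∈T (Adj-new⇒∈ {G = G} adj) (distinct-branches {f = f} (fx≡ f0≡b) fy b≢c ∘ cong suc)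
    ... | suc y , zero  , fy , f0≡c , adj =
      y , x , fy , fx≡ f0≡c ,
      T-clique y x (Adj-new⇒∈ {G = G} adj) x∈T (distinct-branches {f = f} fy (fx≡ f0≡c) b≢c ∘ cong suc)
    ... | suc u , suc v , fu , fv , adj = u , v , fu , fv , adj

  minor-new-alone : (f : Fin (suc n) → Maybe (Fin t)) →
    (∀ a b → a ≢ b → ∃[ u ] ∃[ v ] (f u ≡ just a × f v ≡ just b × Adj (extend G T) u v)) →
    ∀ {a} → f zero ≡ just a → (∀ u → f (suc u) ≢ just a) → t ≤ suc ∣ T ∣
  minor-new-alone {suc t} f touching {a} f0 alone = s≤s (injective⇒≤∣p∣ contact contact-injective contact∈T)
    where
    neighbour : ∀ b → ∃[ y ] f (suc y) ≡ just (punchIn a b) × y ∈ T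
    neighbour b with touching a (punchIn a b) (punchInᵢ≢i a b ∘ sym)
    ... | suc u , _     , fu , _  , _   = contradiction fu (alone u)
    ... | zero  , suc y , _  , fy , adj = y , fy , Adj-new⇒∈ {G = G} adj
    contact : Fin t → Fin n
    contact b = proj₁ (neighbour b)
    contact-injective : ∀ {b c} → contact b ≡ contact c → b ≡ c
    contact-injective {b} {c} e = punchIn-injective a b c
      (just-injective (trans (sym (proj₁ (proj₂ (neighbour b))))
                             (trans (cong (f ∘ suc) e) (proj₁ (proj₂ (neighbour c))))))
    contact∈T : ∀ b → contact b ∈ T
    contact∈T b = proj₂ (proj₂ (neighbour b))

  minor-of-extend-clique : IsCliqueSet G T → HasCliqueMinor (extend G T) t → HasCliqueMinor G t ⊎ t ≤ suc ∣ T ∣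
  minor-of-extend-clique T-clique (f , nonempty , connected , touching) with f zero in f0
  ... | nothing = inj₁ (minor-delete-new T-clique f connected nonempty′ touching′)
    where
    nonempty′ : ∀ a → ∃[ v ] f (suc v) ≡ just a
    nonempty′ a with nonempty a
    ... | zero  , f0≡a = contradiction (trans (sym f0) f0≡a) λ ()
    ... | suc v , fv   = v , fv
    touching′ : ∀ a b → a ≢ b → ∃[ u ] ∃[ v ] (f (suc u) ≡ just a × f (suc v) ≡ just b × Adj G u v)
    touching′ a b a≢b with touching a b a≢b
    ... | zero  , _     , f0≡a , _    , _   = contradiction (trans (sym f0) f0≡a) λ ()
    ... | suc u , zero  , _    , f0≡b , _   = contradiction (trans (sym f0) f0≡b) λ ()
    ... | suc u , suc v , fu   , fv   , adj = u , v , fu , fv , adj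
  ... | just a with any? (λ u → ≡-dec-Maybe _≟_ (f (suc u)) (just a))
  ...   | yes (x₀ , fx₀) = inj₁ (minor-contract-new T-clique f connected nonempty touching f0 fx₀)
  ...   | no  alone      = inj₂ (minor-new-alone f touching f0 (λ u fu → alone (u , fu)))

module _ {k : ℕ} where

  ktree-clique-minor : ∀ {G : Graph n} → KTreeBuild k G → HasCliqueMinor G (suc k)
  ktree-clique-minor base                 = complete-minor
  ktree-clique-minor (step built _ _ _) = minor-extend (ktree-clique-minor built)

  ktree-minor-bound : ∀ {G : Graph n} → KTreeBuild k G → HasCliqueMinor G t → t ≤ suc k
  ktree-minor-bound base minor = minor-size minor
  ktree-minor-bound {t = t} (step built T ∣T∣≡k T-clique) minor with minor-of-extend-clique T-clique minor
  ... | inj₁ minor′ = ktree-minor-bound built minor′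
  ... | inj₂ t≤∣T∣+1 = subst (λ m → t ≤ suc m) ∣T∣≡k t≤∣T∣+1

  ktree-hadwiger : ∀ {G : Graph n} → KTreeBuild k G → IsHadwigerNumber G (suc k)
  ktree-hadwiger built = ktree-clique-minor built , λ _ → ktree-minor-bound built

-- Isomorphism invariance

∣tabulate∣≡sum : ∀ (f : Fin n → Bool) → ∣ tabulate f ∣ ≡ ℕSum.sum (λ i → if f i then 1 else 0)
∣tabulate∣≡sum {zero}  f = refl
∣tabulate∣≡sum {suc n} f with f zero
... | true  = cong suc (∣tabulate∣≡sum (f ∘ suc))
... | false = ∣tabulate∣≡sum (f ∘ suc)

module Relabel {G H : Graph n} (iso : Iso G H) where

  to from : Fin n → Fin n
  to   = Inverse.to (proj₁ iso)
  from = Inverse.from (proj₁ iso)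

  to-from : ∀ i → to (from i) ≡ i
  to-from = Inverse.strictlyInverseˡ (proj₁ iso)

  from-to : ∀ i → from (to i) ≡ i
  from-to = Inverse.strictlyInverseʳ (proj₁ iso)

  E-to : ∀ i j → E G i j ≡ E H (to i) (to j)
  E-to = proj₂ iso

  E-from : ∀ i j → E H i j ≡ E G (from i) (from j)
  E-from i j = sym (trans (E-to (from i) (from j)) (cong₂ (E H) (to-from i) (to-from j)))

  to-injective : ∀ {i j} → to i ≡ to j → i ≡ j
  to-injective {i} {j} e = trans (sym (from-to i)) (trans (cong from e) (from-to j))

  Adj-to : ∀ {u v} → Adj G u v → Adj H (to u) (to v)
  Adj-to {u} {v} adj = trans (sym (E-to u v)) adj

  Adj-from : ∀ {u v} → Adj H u v → Adj G (from u) (from v)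
  Adj-from {u} {v} adj = trans (sym (E-from u v)) adj

  ∣tabulate∘to∣ : ∀ (f : Fin n → Bool) → ∣ tabulate (f ∘ to) ∣ ≡ ∣ tabulate f ∣
  ∣tabulate∘to∣ f = begin
    ∣ tabulate (f ∘ to) ∣                         ≡⟨ ∣tabulate∣≡sum (f ∘ to) ⟩
    ℕSum.sum (λ i → if f (to i) then 1 else 0)   ≡⟨ ℕSum.sum-permute (λ i → if f i then 1 else 0) (proj₁ iso) ⟨
    ℕSum.sum (λ i → if f i then 1 else 0)        ≡⟨ ∣tabulate∣≡sum f ⟨
    ∣ tabulate f ∣                                ∎
    where open ≡-Reasoning

  degree-to : ∀ i → degree G i ≡ degree H (to i)
  degree-to i = trans (cong ∣_∣ (tabulate-cong (E-to i))) (∣tabulate∘to∣ (E H (to i)))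

  minor-pull : HasCliqueMinor H t → HasCliqueMinor G t
  minor-pull (f , nonempty , connected , touching) = f ∘ to , nonempty′ , connected′ , touching′
    where
    nonempty′ : ∀ a → ∃[ v ] f (to v) ≡ just a
    nonempty′ a = from (proj₁ (nonempty a)) , trans (cong f (to-from _)) (proj₂ (nonempty a))
    path-pull : ∀ {P : Fin n → Set} {u v} → PathIn H P u v → PathIn G (P ∘ to) (from u) (from v)
    path-pull {P} {u} (here p)           = here (subst P (sym (to-from u)) p)
    path-pull {P} {u} (there p adj rest) = there (subst P (sym (to-from u)) p) (Adj-from adj) (path-pull rest)
    connected′ : ∀ a u v → f (to u) ≡ just a → f (to v) ≡ just a → PathIn G (λ w → f (to w) ≡ just a) u v
    connected′ a u v fu fv = subst₂ (PathIn G _) (from-to u) (from-to v) (path-pull (connected a (to u) (to v) fu fv))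
    touching′ : ∀ a b → a ≢ b → ∃[ u ] ∃[ v ] (f (to u) ≡ just a × f (to v) ≡ just b × Adj G u v)
    touching′ a b a≢b with touching a b a≢b
    ... | u , v , fu , fv , adj =
      from u , from v , trans (cong f (to-from u)) fu , trans (cong f (to-from v)) fv , Adj-from adj

  pull : Subset n → Subset n
  pull S = tabulate (lookup S ∘ to)

  ∣pull∣ : ∀ S → ∣ pull S ∣ ≡ ∣ S ∣
  ∣pull∣ S = trans (∣tabulate∘to∣ (lookup S)) (cong ∣_∣ (tabulate∘lookup S))

  ∈-pull : ∀ {S v} → v ∈ S → from v ∈ pull S
  ∈-pull {S} {v} v∈S = lookup⇒[]= (from v) (pull S)
    (trans (lookup∘tabulate _ (from v)) (trans (cong (lookup S) (to-from v)) ([]=⇒lookup v∈S)))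

  filled-pull : ∀ {S v} → Filled H S v → Filled G (pull S) (from v)
  filled-pull (init v∈S) = init (∈-pull v∈S)
  filled-pull {S} (force {u} {v} filled adj rest) = force (filled-pull filled) (Adj-from adj) rest′
    where
    rest′ : ∀ w → Adj G (from u) w → w ≢ from v → Filled G (pull S) w
    rest′ w adjw w≢v = subst (Filled G (pull S)) (from-to w)
      (filled-pull (rest (to w) (subst (λ x → Adj H x (to w)) (to-from u) (Adj-to adjw))
                              (λ e → w≢v (trans (sym (from-to w)) (cong from e)))))

  zero-forcing-pull : ∀ {S} → IsZeroForcingSet H S → IsZeroForcingSet G (pull S)
  zero-forcing-pull zero-forcing v = subst (Filled G _) (from-to v) (filled-pull (zero-forcing (to v)))

module IsoInvariance {G H : Graph n} (iso : Iso G H) where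

  iso-sym : Iso H G
  iso-sym = ↔-sym (proj₁ iso) , Relabel.E-from {G = G} {H = H} iso

  hadwiger-iso : IsHadwigerNumber H t → IsHadwigerNumber G t
  hadwiger-iso (minor , bound) =
    Relabel.minor-pull {G = G} {H = H} iso minor , λ s → bound s ∘ Relabel.minor-pull {G = H} {H = G} iso-sym

  zero-forcing-set-iso : ∀ {m} → Σ (Subset n) (λ S → ∣ S ∣ ≡ m × IsZeroForcingSet H S) →
                         Σ (Subset n) (λ S → ∣ S ∣ ≡ m × IsZeroForcingSet G S)
  zero-forcing-set-iso (S , ∣S∣≡m , zero-forcing) = pull S , trans (∣pull∣ S) ∣S∣≡m , zero-forcing-pull zero-forcing
    where open Relabel {G = G} {H = H} iso

  zero-forcing-bound-iso : ∀ {m} → (∀ S → IsZeroForcingSet H S → m ≤ ∣ S ∣) → ∀ S → IsZeroForcingSet G S → m ≤ ∣ S ∣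
  zero-forcing-bound-iso {m} bound S zero-forcing =
    subst (m ≤_) (∣pull∣ S) (bound (pull S) (zero-forcing-pull zero-forcing))
    where open Relabel {G = H} {H = G} iso-sym

-- Maximum nullity

module MaximumNullity (R : Reals) where

  open Reals R renaming (_<_ to _<ℝ_; refl to ≈-refl; sym to ≈-sym; trans to ≈-trans; reflexive to ≈-reflexive)
    hiding (zero)
  open import Algebra.Properties.Semiring.Sum semiring
    using (sum; sum-cong-≋; sum-cong-≗; sum-remove; sum-replicate-zero; ∑-comm; ∑-distrib-+;
           *-distribˡ-sum; *-distribʳ-sum; sum-permute)
  open import Algebra.Properties.Ring (CommutativeRing.ring ℝring) using (-‿distribˡ-*; -‿involutive)
  open import Algebra.Properties.CommutativeSemigroup *-commutativeSemigroup using (x∙yz≈y∙xz)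
  open import Relation.Binary.Reasoning.Setoid setoid

  sumF≡sum : ∀ {m} (f : Fin m → Carrier) → sumF R f ≡ sum f
  sumF≡sum {zero}  f = refl
  sumF≡sum {suc m} f = cong (f zero +_) (sumF≡sum (f ∘ suc))

  sum-zero : ∀ {m} {f : Fin m → Carrier} → (∀ i → f i ≈ 0#) → sum f ≈ 0#
  sum-zero {m} f≈0 = ≈-trans (sum-cong-≋ f≈0) (sum-replicate-zero m)

  sum-single : ∀ {m} (f : Fin m → Carrier) p → (∀ i → i ≢ p → f i ≈ 0#) → sum f ≈ f p
  sum-single {suc m} f p zero-elsewhere = begin
    sum f                          ≈⟨ sum-remove {i = p} f ⟩
    f p + sum (f ∘ punchIn p)      ≈⟨ +-congˡ (sum-zero (λ i → zero-elsewhere (punchIn p i) (punchInᵢ≢i p i))) ⟩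
    f p + 0#                       ≈⟨ +-identityʳ (f p) ⟩
    f p                            ∎

  <⇒≉ : ∀ {x y} → x <ℝ y → ¬ x ≈ y
  <⇒≉ x<y x≈y = <-irrefl (<-resp-≈ x≈y ≈-refl x<y)

  _≈0? : ∀ x → Dec (x ≈ 0#)
  x ≈0? with <-trichot x 0#
  ... | inj₁ x<0        = no (<⇒≉ x<0)
  ... | inj₂ (inj₁ x≈0) = yes x≈0
  ... | inj₂ (inj₂ 0<x) = no (<⇒≉ 0<x ∘ ≈-sym)

  x*y≈0⇒y≈0 : ∀ {x y} → ¬ x ≈ 0# → x * y ≈ 0# → y ≈ 0#
  x*y≈0⇒y≈0 {x} {y} x≉0 xy≈0 with inverse x x≉0
  ... | x⁻¹ , xx⁻¹≈1 = begin
    y               ≈⟨ *-identityˡ y ⟨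
    1# * y          ≈⟨ *-congʳ xx⁻¹≈1 ⟨
    (x * x⁻¹) * y   ≈⟨ *-congʳ (*-comm x x⁻¹) ⟩
    (x⁻¹ * x) * y   ≈⟨ *-assoc x⁻¹ x y ⟩
    x⁻¹ * (x * y)   ≈⟨ *-congˡ xy≈0 ⟩
    x⁻¹ * 0#        ≈⟨ zeroʳ x⁻¹ ⟩
    0#              ∎

  0<1 : 0# <ℝ 1#
  0<1 with <-trichot 0# 1#
  ... | inj₁ 0<1        = 0<1
  ... | inj₂ (inj₁ 0≈1) = contradiction 0≈1 0≉1
  ... | inj₂ (inj₂ 1<0) = <-resp-≈ ≈-refl [-1][-1]≈1 (<-* 0<-1 0<-1)
    where
    0<-1 : 0# <ℝ (- 1#)
    0<-1 = <-resp-≈ (-‿inverseʳ 1#) (+-identityˡ (- 1#)) (<-+ (- 1#) 1<0)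
    [-1][-1]≈1 : - 1# * - 1# ≈ 1#
    [-1][-1]≈1 = ≈-trans (≈-sym (-‿distribˡ-* 1# (- 1#))) (≈-trans (-‿cong (*-identityˡ (- 1#))) (-‿involutive 1#))

  Nonneg : Carrier → Set
  Nonneg x = 0# <ℝ x ⊎ 0# ≈ x

  pos+nonneg : ∀ {x y} → 0# <ℝ x → Nonneg y → 0# <ℝ (x + y)
  pos+nonneg {x} {y} 0<x (inj₁ 0<y) = <-trans 0<y (<-resp-≈ (+-identityˡ y) ≈-refl (<-+ y 0<x))
  pos+nonneg {x} {y} 0<x (inj₂ 0≈y) = <-resp-≈ ≈-refl (≈-trans (≈-sym (+-identityʳ x)) (+-congˡ 0≈y)) 0<x

  nonneg+nonneg : ∀ {x y} → Nonneg x → Nonneg y → Nonneg (x + y)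
  nonneg+nonneg (inj₁ 0<x) nonneg-y = inj₁ (pos+nonneg 0<x nonneg-y)
  nonneg+nonneg {x} {y} (inj₂ 0≈x) nonneg-y =
    [ (λ 0<y → inj₁ (<-resp-≈ ≈-refl y≈x+y 0<y)) , (λ 0≈y → inj₂ (≈-trans 0≈y y≈x+y)) ]′ nonneg-y
    where
    y≈x+y : y ≈ x + y
    y≈x+y = ≈-trans (≈-sym (+-identityˡ y)) (+-congʳ 0≈x)

  sum-nonneg : ∀ {m} (f : Fin m → Carrier) → (∀ i → Nonneg (f i)) → Nonneg (sum f)
  sum-nonneg {zero}  f _          = inj₂ ≈-refl
  sum-nonneg {suc m} f nonneg = nonneg+nonneg (nonneg zero) (sum-nonneg (f ∘ suc) (nonneg ∘ suc))

  sum-pos : ∀ {m} (f : Fin m → Carrier) → (∀ i → Nonneg (f i)) → ∀ p → 0# <ℝ f p → 0# <ℝ sum f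
  sum-pos {suc m} f nonneg p 0<fp =
    <-resp-≈ ≈-refl (≈-sym (sum-remove {i = p} f)) (pos+nonneg 0<fp (sum-nonneg (f ∘ punchIn p) (nonneg ∘ punchIn p)))

  𝟙 : Bool → Carrier
  𝟙 true  = 1#
  𝟙 false = 0#

  indicator : ∀ {n} → Subset n → Fin n → Carrier
  indicator S j = 𝟙 (lookup S j)

  indicator-∈ : ∀ {n} {S : Subset n} {j} → j ∈ S → indicator S j ≡ 1#
  indicator-∈ j∈S rewrite []=⇒lookup j∈S = refl

  indicator-∉ : ∀ {n} {S : Subset n} {j} → j ∉ S → indicator S j ≡ 0#
  indicator-∉ j∉S rewrite x∉p⇒lookup≡outside j∉S = refl

  𝟙*𝟙-nonneg : ∀ a b → Nonneg (𝟙 a * 𝟙 b)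
  𝟙*𝟙-nonneg true  true  = inj₁ (<-resp-≈ ≈-refl (≈-sym (*-identityˡ 1#)) 0<1)
  𝟙*𝟙-nonneg true  false = inj₂ (≈-sym (zeroʳ 1#))
  𝟙*𝟙-nonneg false b     = inj₂ (≈-sym (zeroˡ (𝟙 b)))

  record ZeroSumCliqueCover (k : ℕ) {n} (G : Graph n) : Set where
    field
      size             : ℕ
      clique           : Fin size → Subset n
      clique-complete  : ∀ c → IsCliqueSet G (clique c)
      edge-covered     : ∀ i j → Adj G i j → ∃[ c ] i ∈ clique c × j ∈ clique c
      vector           : Fin k → Fin n → Carrier
      zero-sum         : ∀ a c → sum (λ j → indicator (clique c) j * vector a j) ≈ 0#
      independent      : LinIndep R vector

  module _ {k n} {G : Graph n} (cover : ZeroSumCliqueCover k G) where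
    open ZeroSumCliqueCover cover

    cover-matrix : Matrix R n
    cover-matrix i j = sum (λ c → indicator (clique c) i * indicator (clique c) j)

    cover-matrix-∈S : InS R G cover-matrix
    cover-matrix-∈S =
      (λ i j → sum-cong-≋ (λ c → *-comm (indicator (clique c) i) (indicator (clique c) j))) , off-diagonal
      where
      off-diagonal : ∀ i j → i ≢ j → (¬ cover-matrix i j ≈ 0# → Adj G i j) × (Adj G i j → ¬ cover-matrix i j ≈ 0#)
      off-diagonal i j i≢j = nonzero⇒Adj , Adj⇒nonzero
        where
        term-zero : ¬ Adj G i j → ∀ c → indicator (clique c) i * indicator (clique c) j ≈ 0#
        term-zero ¬adj c with i ∈? clique c | j ∈? clique c
        ... | yes i∈ | yes j∈ = contradiction (clique-complete c i j i∈ j∈ i≢j) ¬adj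
        ... | no  i∉ | _      = ≈-trans (*-congʳ (≈-reflexive (indicator-∉ i∉))) (zeroˡ _)
        ... | yes _  | no  j∉ = ≈-trans (*-congˡ (≈-reflexive (indicator-∉ j∉))) (zeroʳ _)
        nonzero⇒Adj : ¬ cover-matrix i j ≈ 0# → Adj G i j
        nonzero⇒Adj nonzero with E G i j Bool.≟ true
        ... | yes adj = adj
        ... | no ¬adj = contradiction (sum-zero (term-zero ¬adj)) nonzero
        Adj⇒nonzero : Adj G i j → ¬ cover-matrix i j ≈ 0#
        Adj⇒nonzero adj with edge-covered i j adj
        ... | c , i∈ , j∈ = <⇒≉ (sum-pos term (λ c′ → 𝟙*𝟙-nonneg (lookup (clique c′) i) (lookup (clique c′) j)) c 0<term) ∘ ≈-sym
          where
          term : Fin size → Carrier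
          term c′ = indicator (clique c′) i * indicator (clique c′) j
          0<term : 0# <ℝ (indicator (clique c) i * indicator (clique c) j)
          0<term rewrite indicator-∈ i∈ | indicator-∈ j∈ = <-resp-≈ ≈-refl (≈-sym (*-identityˡ 1#)) 0<1

    cover-matrix-kernel : ∀ a → InKernel R cover-matrix (vector a)
    cover-matrix-kernel a i = begin
      sumF R (λ j → cover-matrix i j * vector a j)
        ≡⟨ sumF≡sum (λ j → cover-matrix i j * vector a j) ⟩
      sum (λ j → sum (λ c → 𝟙ᵢ c * 𝟙ⱼ c j) * vector a j)
        ≈⟨ sum-cong-≋ (λ j → *-distribʳ-sum (vector a j) (λ c → 𝟙ᵢ c * 𝟙ⱼ c j)) ⟩
      sum (λ j → sum (λ c → 𝟙ᵢ c * 𝟙ⱼ c j * vector a j))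
        ≈⟨ ∑-comm (λ j c → 𝟙ᵢ c * 𝟙ⱼ c j * vector a j) ⟩
      sum (λ c → sum (λ j → 𝟙ᵢ c * 𝟙ⱼ c j * vector a j))
        ≈⟨ sum-cong-≋ factor ⟩
      sum (λ c → 𝟙ᵢ c * sum (λ j → 𝟙ⱼ c j * vector a j))
        ≈⟨ sum-zero (λ c → ≈-trans (*-congˡ (zero-sum a c)) (zeroʳ _)) ⟩
      0# ∎
      where
      𝟙ᵢ : Fin size → Carrier
      𝟙ᵢ c = indicator (clique c) i
      𝟙ⱼ : Fin size → Fin n → Carrier
      𝟙ⱼ c j = indicator (clique c) j
      factor : ∀ c → sum (λ j → 𝟙ᵢ c * 𝟙ⱼ c j * vector a j) ≈ 𝟙ᵢ c * sum (λ j → 𝟙ⱼ c j * vector a j)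
      factor c = ≈-trans (sum-cong-≋ (λ j → *-assoc (𝟙ᵢ c) (𝟙ⱼ c j) (vector a j)))
                       (≈-sym (*-distribˡ-sum (𝟙ᵢ c) (λ j → 𝟙ⱼ c j * vector a j)))

    cover-nullity : Σ (Matrix R n) λ A → InS R G A × NullityAtLeast R A k
    cover-nullity = cover-matrix , cover-matrix-∈S , vector , cover-matrix-kernel , independent

  δ : ∀ {n} → Fin n → Fin n → Carrier
  δ i j with i ≟ j
  ... | yes _ = 1#
  ... | no  _ = 0#

  δ-refl : ∀ {n} (i : Fin n) → δ i i ≈ 1#
  δ-refl i with i ≟ i
  ... | yes _   = ≈-refl
  ... | no  i≢i = contradiction refl i≢i

  δ-≢ : ∀ {n} {i j : Fin n} → i ≢ j → δ i j ≈ 0#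
  δ-≢ {i = i} {j} i≢j with i ≟ j
  ... | yes i≡j = contradiction i≡j i≢j
  ... | no  _   = ≈-refl

  complete-cover : ∀ k → ZeroSumCliqueCover k (complete (suc k))
  complete-cover k = record
    { size            = 1
    ; clique          = λ _ → ⊤
    ; clique-complete = λ _ i j _ _ → Adj-complete
    ; edge-covered    = λ _ _ _ → zero , ∈⊤ , ∈⊤
    ; vector          = difference
    ; zero-sum        = λ a _ → zero-sum a
    ; independent     = independent
    }
    where
    difference : Fin k → Fin (suc k) → Carrier
    difference a zero    = - 1#
    difference a (suc j) = δ j a
    zero-sum : ∀ a → sum (λ j → indicator ⊤ j * difference a j) ≈ 0#
    zero-sum a = begin
      sum (λ j → indicator ⊤ j * difference a j)
        ≈⟨ sum-cong-≋ (λ j → ≈-trans (*-congʳ (≈-reflexive (indicator-∈ {S = ⊤} {j = j} ∈⊤)))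
                                      (*-identityˡ (difference a j))) ⟩
      - 1# + sum (λ j → δ j a)      ≈⟨ +-congˡ (sum-single (λ j → δ j a) a (λ j → δ-≢)) ⟩
      - 1# + δ a a                  ≈⟨ +-congˡ (δ-refl a) ⟩
      - 1# + 1#                     ≈⟨ -‿inverseˡ 1# ⟩
      0#                            ∎
    independent : LinIndep R difference
    independent c combination≈0 b = begin
      c b                           ≈⟨ *-identityʳ (c b) ⟨
      c b * 1#                      ≈⟨ *-congˡ (δ-refl b) ⟨
      c b * δ b b                   ≈⟨ sum-single (λ a → c a * δ b a) b
                                         (λ a a≢b → ≈-trans (*-congˡ (δ-≢ (a≢b ∘ sym))) (zeroʳ (c a))) ⟨
      sum (λ a → c a * δ b a)       ≡⟨ sumF≡sum (λ a → c a * δ b a) ⟨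
      sumF R (λ a → c a * δ b a)    ≈⟨ combination≈0 (suc b) ⟩
      0#                            ∎

  extend-cover : ∀ {k n} {G : Graph n} {T : Subset n} → IsCliqueSet G T →
                 ZeroSumCliqueCover k G → ZeroSumCliqueCover k (extend G T)
  extend-cover {k} {n} {G} {T} T-clique cover = record
    { size            = suc size
    ; clique          = clique′
    ; clique-complete = clique′-complete
    ; edge-covered    = edge-covered′
    ; vector          = vector′
    ; zero-sum        = zero-sum′
    ; independent     = λ c combination≈0 → independent c (combination≈0 ∘ suc)
    }
    where
    open ZeroSumCliqueCover cover
    clique′ : Fin (suc size) → Subset (suc n)
    clique′ zero    = inside ∷ T
    clique′ (suc c) = outside ∷ clique c
    clique′-complete : ∀ c → IsCliqueSet (extend G T) (clique′ c)
    clique′-complete zero    zero    (suc j) _          (there j∈T) _   = ∈⇒Adj-new {G = G} j∈T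
    clique′-complete zero    (suc i) zero    (there i∈T) _          _   = ∈⇒Adj-new {G = G} i∈T
    clique′-complete zero    (suc i) (suc j) (there i∈T) (there j∈T) i≢j = T-clique i j i∈T j∈T (i≢j ∘ cong suc)
    clique′-complete zero    zero    zero    _          _           0≢0 = contradiction refl 0≢0
    clique′-complete (suc c) (suc i) (suc j) (there i∈C) (there j∈C) i≢j = clique-complete c i j i∈C j∈C (i≢j ∘ cong suc)
    edge-covered′ : ∀ i j → Adj (extend G T) i j → ∃[ c ] i ∈ clique′ c × j ∈ clique′ c
    edge-covered′ zero    (suc j) adj = zero , here , there (Adj-new⇒∈ {G = G} adj)
    edge-covered′ (suc i) zero    adj = zero , there (Adj-new⇒∈ {G = G} adj) , here
    edge-covered′ (suc i) (suc j) adj with edge-covered i j adj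
    ... | c , i∈C , j∈C = suc c , there i∈C , there j∈C
    -- the value at the new vertex makes the new clique inside ∷ T sum to zero
    vector′ : Fin k → Fin (suc n) → Carrier
    vector′ a zero    = - sum (λ j → indicator T j * vector a j)
    vector′ a (suc j) = vector a j
    zero-sum′ : ∀ a c → sum (λ j → indicator (clique′ c) j * vector′ a j) ≈ 0#
    zero-sum′ a zero    = ≈-trans (+-congʳ (*-identityˡ _)) (-‿inverseˡ _)
    zero-sum′ a (suc c) = ≈-trans (+-cong (zeroˡ _) (zero-sum a c)) (+-identityˡ 0#)

  ktree-cover : ∀ {k n} {G : Graph n} → KTreeBuild k G → ZeroSumCliqueCover k G
  ktree-cover {k} base                     = complete-cover k
  ktree-cover (step built T _ T-clique) = extend-cover T-clique (ktree-cover built)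

  nullity-witness-iso : ∀ {n m} {G H : Graph n} → Iso G H →
    Σ (Matrix R n) (λ A → InS R H A × NullityAtLeast R A m) →
    Σ (Matrix R n) (λ A → InS R G A × NullityAtLeast R A m)
  nullity-witness-iso {n} {m} {G} {H} iso (A , (A-sym , A-pattern) , v , kernel , independent) =
    A′ , ((λ i j → A-sym (to i) (to j)) , pattern′) , v′ , kernel′ , independent′
    where
    open Relabel {G = G} {H = H} iso
    A′ : Matrix R n
    A′ i j = A (to i) (to j)
    v′ : Fin m → Fin n → Carrier
    v′ a i = v a (to i)
    pattern′ : ∀ i j → i ≢ j → (¬ A′ i j ≈ 0# → Adj G i j) × (Adj G i j → ¬ A′ i j ≈ 0#)
    pattern′ i j i≢j with A-pattern (to i) (to j) (i≢j ∘ to-injective)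
    ... | nonzero⇒Adj , Adj⇒nonzero = trans (E-to i j) ∘ nonzero⇒Adj , Adj⇒nonzero ∘ Adj-to
    kernel′ : ∀ a → InKernel R A′ (v′ a)
    kernel′ a i = begin
      sumF R (λ j → A (to i) (to j) * v a (to j))  ≡⟨ sumF≡sum (λ j → A (to i) (to j) * v a (to j)) ⟩
      sum (λ j → A (to i) (to j) * v a (to j))     ≈⟨ sum-permute (λ j → A (to i) j * v a j) (proj₁ iso) ⟨
      sum (λ j → A (to i) j * v a j)               ≡⟨ sumF≡sum (λ j → A (to i) j * v a j) ⟨
      sumF R (λ j → A (to i) j * v a j)            ≈⟨ kernel a (to i) ⟩
      0#                                           ∎
    independent′ : LinIndep R v′
    independent′ c combination≈0 = independent c λ j →
      subst (λ x → sumF R (λ a → c a * v a x) ≈ 0#) (to-from j) (combination≈0 (from j))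

  -- When u forces v, row u of A z = 0 has A u v * z v as its only possibly nonzero term.
  kernel-vanishes-on-filled : ∀ {n} {G : Graph n} {A : Matrix R n} {S z} → InS R G A → InKernel R A z →
    (∀ {i} → i ∈ S → z i ≈ 0#) → ∀ {v} → Filled G S v → z v ≈ 0#
  kernel-vanishes-on-filled _ _ z≈0-on-S (init v∈S) = z≈0-on-S v∈S
  kernel-vanishes-on-filled {G = G} {A} {S} {z} A∈S kernel z≈0-on-S (force {u} {v} filled adj rest) =
    x*y≈0⇒y≈0 (proj₂ (proj₂ A∈S u v (Adj⇒≢ {G = G} adj)) adj) (begin
      A u v * z v                ≈⟨ sum-single (λ j → A u j * z j) v other-terms ⟨
      sum (λ j → A u j * z j)    ≡⟨ sumF≡sum (λ j → A u j * z j) ⟨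
      sumF R (λ j → A u j * z j) ≈⟨ kernel u ⟩
      0#                         ∎)
    where
    other-terms : ∀ j → j ≢ v → A u j * z j ≈ 0#
    other-terms j j≢v with j ≟ u | E G u j Bool.≟ true
    ... | yes refl | _       = ≈-trans (*-congˡ (kernel-vanishes-on-filled A∈S kernel z≈0-on-S filled)) (zeroʳ _)
    ... | no  _    | yes adj = ≈-trans (*-congˡ (kernel-vanishes-on-filled A∈S kernel z≈0-on-S (rest j adj j≢v))) (zeroʳ _)
    ... | no  j≢u  | no ¬adj with A u j ≈0?
    ...   | yes Auj≈0 = ≈-trans (*-congʳ Auj≈0) (zeroˡ _)
    ...   | no  Auj≉0 = contradiction (proj₁ (proj₂ A∈S u j (j≢u ∘ sym)) Auj≉0) ¬adj

  LinDep : ∀ {r m} → (Fin r → Fin m → Carrier) → Set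
  LinDep {r} w = Σ (Fin r → Carrier) λ c → (∃[ q ] ¬ c q ≈ 0#) × (∀ i → sum (λ a → c a * w a i) ≈ 0#)

  -- One step of Gaussian elimination: a relation d among the cleared vectors lifts to the w's,
  -- the pivot w p receiving the coefficient Σ_b d b * μ b.
  eliminate-first-coordinate : ∀ {m} (w : Fin (suc (suc m)) → Fin (suc m) → Carrier) p (μ : Fin (suc m) → Carrier) →
    (∀ b → w (punchIn p b) zero + μ b * w p zero ≈ 0#) →
    LinDep (λ b i → w (punchIn p b) (suc i) + μ b * w p (suc i)) → LinDep w
  eliminate-first-coordinate w p μ cleared (d , (q , dq≉0) , d-relation) =
    c , (punchIn p q , dq≉0 ∘ ≈-trans (≈-reflexive (sym (insertAt-punchIn d p cₚ q)))) , relation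
    where
    cₚ : Carrier
    cₚ = sum (λ b → d b * μ b)
    c : Fin (suc (suc _)) → Carrier
    c = insertAt d p cₚ
    w′ : Fin _ → Fin (suc _) → Carrier
    w′ b i = w (punchIn p b) i + μ b * w p i
    regroup : ∀ i → sum (λ a → c a * w a i) ≈ sum (λ b → d b * w′ b i)
    regroup i = begin
      sum (λ a → c a * w a i)
        ≈⟨ sum-remove {i = p} (λ a → c a * w a i) ⟩
      c p * w p i + sum (λ b → c (punchIn p b) * w (punchIn p b) i)
        ≈⟨ +-cong (*-congʳ (≈-reflexive (insertAt-lookup d p cₚ)))
                  (≈-reflexive (sum-cong-≗ (λ b → cong (_* w (punchIn p b) i) (insertAt-punchIn d p cₚ b)))) ⟩
      cₚ * w p i + sum (λ b → d b * w (punchIn p b) i)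
        ≈⟨ +-comm _ _ ⟩
      sum (λ b → d b * w (punchIn p b) i) + cₚ * w p i
        ≈⟨ +-congˡ (*-distribʳ-sum (w p i) (λ b → d b * μ b)) ⟩
      sum (λ b → d b * w (punchIn p b) i) + sum (λ b → d b * μ b * w p i)
        ≈⟨ ∑-distrib-+ (λ b → d b * w (punchIn p b) i) (λ b → d b * μ b * w p i) ⟨
      sum (λ b → d b * w (punchIn p b) i + d b * μ b * w p i)
        ≈⟨ sum-cong-≋ (λ b → ≈-trans (+-congˡ (*-assoc (d b) (μ b) (w p i)))
                                      (≈-sym (distribˡ (d b) (w (punchIn p b) i) (μ b * w p i)))) ⟩
      sum (λ b → d b * w′ b i) ∎
    relation : ∀ i → sum (λ a → c a * w a i) ≈ 0#
    relation zero    = ≈-trans (regroup zero) (sum-zero (λ b → ≈-trans (*-congˡ (cleared b)) (zeroʳ (d b))))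
    relation (suc i) = ≈-trans (regroup (suc i)) (d-relation i)

  first-coordinate-pivot : ∀ {m} (w : Fin (suc (suc m)) → Fin (suc m) → Carrier) →
    ∃[ p ] ∃[ μ ] (∀ b → w (punchIn p b) zero + μ b * w p zero ≈ 0#)
  first-coordinate-pivot w with any? (λ p → ¬? (w p zero ≈0?))
  ... | yes (p , wₚ≉0) with inverse (w p zero) wₚ≉0
  ...   | r , wₚr≈1 = p , (λ b → - (w (punchIn p b) zero * r)) , λ b → cancel (w (punchIn p b) zero)
    where
    cancel : ∀ x → x + - (x * r) * w p zero ≈ 0#
    cancel x = begin
      x + - (x * r) * w p zero    ≈⟨ +-congˡ (≈-sym (-‿distribˡ-* (x * r) (w p zero))) ⟩
      x + - (x * r * w p zero)    ≈⟨ +-congˡ (-‿cong (≈-trans (*-assoc x r (w p zero))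
                                                             (*-congˡ (≈-trans (*-comm r (w p zero)) wₚr≈1)))) ⟩
      x + - (x * 1#)              ≈⟨ +-congˡ (-‿cong (*-identityʳ x)) ⟩
      x + - x                     ≈⟨ -‿inverseʳ x ⟩
      0#                          ∎
  first-coordinate-pivot w | no none =
    zero , (λ _ → 0#) , λ b → ≈-trans (+-congˡ (zeroˡ _)) (≈-trans (+-identityʳ _) (w₀≈0 (suc b)))
    where
    w₀≈0 : ∀ a → w a zero ≈ 0#
    w₀≈0 a with w a zero ≈0?
    ... | yes w≈0 = w≈0
    ... | no  w≉0 = contradiction (a , w≉0) none

  vectors-dependent : ∀ m (w : Fin (suc m) → Fin m → Carrier) → LinDep w
  vectors-dependent zero    w = (λ _ → 1#) , (zero , 0≉1 ∘ ≈-sym) , λ ()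
  vectors-dependent (suc m) w with first-coordinate-pivot w
  ... | p , μ , cleared =
    eliminate-first-coordinate w p μ cleared (vectors-dependent m (λ b i → w (punchIn p b) (suc i) + μ b * w p (suc i)))

  kernel-combination : ∀ {n m} {A : Matrix R n} {v : Fin m → Fin n → Carrier} →
    (∀ a → InKernel R A (v a)) → ∀ (c : Fin m → Carrier) → InKernel R A (λ j → sum (λ a → c a * v a j))
  kernel-combination {A = A} {v} kernel c i = begin
    sumF R (λ j → A i j * sum (λ a → c a * v a j))
      ≡⟨ sumF≡sum (λ j → A i j * sum (λ a → c a * v a j)) ⟩
    sum (λ j → A i j * sum (λ a → c a * v a j))
      ≈⟨ sum-cong-≋ (λ j → *-distribˡ-sum (A i j) (λ a → c a * v a j)) ⟩
    sum (λ j → sum (λ a → A i j * (c a * v a j)))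
      ≈⟨ ∑-comm (λ j a → A i j * (c a * v a j)) ⟩
    sum (λ a → sum (λ j → A i j * (c a * v a j)))
      ≈⟨ sum-cong-≋ factor ⟩
    sum (λ a → c a * sumF R (λ j → A i j * v a j))
      ≈⟨ sum-zero (λ a → ≈-trans (*-congˡ (kernel a i)) (zeroʳ (c a))) ⟩
    0# ∎
    where
    factor : ∀ a → sum (λ j → A i j * (c a * v a j)) ≈ c a * sumF R (λ j → A i j * v a j)
    factor a = begin
      sum (λ j → A i j * (c a * v a j))  ≈⟨ sum-cong-≋ (λ j → x∙yz≈y∙xz (A i j) (c a) (v a j)) ⟩
      sum (λ j → c a * (A i j * v a j))  ≈⟨ *-distribˡ-sum (c a) (λ j → A i j * v a j) ⟨
      c a * sum (λ j → A i j * v a j)    ≡⟨ cong (c a *_) (sumF≡sum (λ j → A i j * v a j)) ⟨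
      c a * sumF R (λ j → A i j * v a j) ∎

  nullity≤zero-forcing : ∀ {n} {G : Graph n} {S} → IsZeroForcingSet G S →
    ∀ A → InS R G A → ¬ NullityAtLeast R A (suc ∣ S ∣)
  nullity≤zero-forcing {n} {G} {S} zero-forcing A A∈S (v , kernel , independent)
    with enumerate S
  ... | e , covers with vectors-dependent ∣ S ∣ (λ a p → v a (e p))
  ...   | c , (q , c≉0) , vanishes-on-S = c≉0 (independent c z≈0 q)
    where
    z : Fin n → Carrier
    z j = sum (λ a → c a * v a j)
    z≈0-on-S : ∀ {i} → i ∈ S → z i ≈ 0#
    z≈0-on-S i∈S with covers i∈S
    ... | p , refl = vanishes-on-S p
    z≈0 : ∀ j → sumF R (λ a → c a * v a j) ≈ 0#
    z≈0 j = ≈-trans (≈-reflexive (sumF≡sum (λ a → c a * v a j)))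
                  (kernel-vanishes-on-filled A∈S (kernel-combination kernel c) z≈0-on-S (zero-forcing j))

linear-ktree-zero-forcing-set : ∀ {k n} {G H : Graph n} → 1 ≤ k → KTreeBuild k H → Iso G H →
  (IsComplete G × n ≡ suc k) ⊎
  (Σ (Fin n) λ a → Σ (Fin n) λ b → a ≢ b × degree G a ≡ k × degree G b ≡ k ×
     (∀ c → degree G c ≡ k → c ≡ a ⊎ c ≡ b)) →
  Σ (Subset n) λ S → ∣ S ∣ ≡ k × IsZeroForcingSet G S
linear-ktree-zero-forcing-set {suc k} (s≤s z≤n) _ _ (inj₁ (complete , refl)) =
  outside ∷ ⊤ , ∣⊤∣≡n (suc k) , complete-zero-forcing-set complete
linear-ktree-zero-forcing-set {k} {G = G} {H} 1≤k built G≅H (inj₂ (a , b , _ , deg-a , deg-b , simplicial)) =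
  zero-forcing-set-iso (ktree-zero-forcing-set k 1≤k built (degree-in-H deg-a) (degree-in-H deg-b) simplicial-in-H)
  where
  open Relabel {G = G} {H = H} G≅H
  open IsoInvariance {G = G} {H = H} G≅H
  degree-in-H : ∀ {c} → degree G c ≡ k → degree H (to c) ≡ k
  degree-in-H {c} deg = trans (sym (degree-to c)) deg
  simplicial-in-H : ∀ c → degree H c ≡ k → c ≡ to a ⊎ c ≡ to b
  simplicial-in-H c deg =
    Sum.map to-≡ to-≡ (simplicial (from c) (trans (degree-to (from c)) (trans (cong (degree H) (to-from c)) deg)))
    where
    to-≡ : ∀ {x} → from c ≡ x → c ≡ to x
    to-≡ e = trans (sym (to-from c)) (cong to e)

theorem4p25 : (R : Reals) (k : ℕ) → 1 ≤ k → ∀ {n} (G : Graph n) →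
    IsLinearKTree k G →
    IsHadwigerNumber G (suc k) × IsMaxNullity R G k × IsZeroForcingNumber G k
theorem4p25 R k 1≤k G ((H , built , G≅H) , shape) =
  hadwiger-iso (ktree-hadwiger built) ,
  (nullity-witness-iso {G = G} {H = H} G≅H (cover-nullity (ktree-cover built)) , nullity-bound) ,
  zero-forcing
  where
  open MaximumNullity R
  open IsoInvariance {G = G} {H = H} G≅H
  zero-forcing : IsZeroForcingNumber G k
  zero-forcing = linear-ktree-zero-forcing-set 1≤k built G≅H shape ,
                 zero-forcing-bound-iso (zero-forcing-≥-min-degree (ℕ.<⇒≤ (ktree-size built)) (ktree-min-degree built))
  nullity-bound : ∀ A → InS R G A → ¬ NullityAtLeast R A (suc k)
  nullity-bound A A∈S with proj₁ zero-forcing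
  ... | S , ∣S∣≡k , forcing = subst (λ m → ¬ NullityAtLeast R A (suc m)) ∣S∣≡k (nullity≤zero-forcing forcing A A∈S)
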